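{- Let $E=\{1,\ 7^2,\ 13^2,\ 17^2,\ 19^2,\ 23^2,\ 29^2,\ 31^2,\ 7\cdot 103,\ 1201,\ 7\cdot 127,\ 23\cdot 47\}$ (a set of residues modulo $1320$). For every prime number $n$ whose residue modulo $1320$ does not lie in $E$, there exist positive integers $a\le b\le c$ with $\frac{4}{n}=\frac{1}{a}+\frac{1}{b}+\frac{1}{c}$. Moreover, $$\mathbb N\setminus \mathcal C_3\subset \{n\in\mathbb N : (n \bmod 1320)\in E\}.$$
   Context: $\mathbb N$ denotes the positive integers. For $n\in\mathbb N$, a solution of $\frac{4}{n}=\frac{1}{a}+\frac{1}{b}+\frac{1}{c}$ means positive integers $a\le b\le c$ (not necessarily distinct) satisfying this equality. For $i\in\mathbb N$, $\mathcal C_i$ denotes the set of all $n\in\mathbb N$ for which this equation has a solution with $a\le \frac{n+4i-1}{4}$. -}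

module Defs where

open import Data.Nat using (ℕ; _+_; _*_; _≤_; _%_; _∸_)
open import Data.Nat.Primality using (Prime)
open import Data.List using (List; []; _∷_)
open import Data.List.Membership.Propositional using (_∈_)
open import Data.Product using (Σ; _×_; ∃-syntax)
open import Relation.Binary.PropositionalEquality using (_≡_)
open import Relation.Nullary using (¬_)

E : List ℕ
E = 1 ∷ (7 * 7) ∷ (13 * 13) ∷ (17 * 17) ∷ (19 * 19) ∷ (23 * 23) ∷ (29 * 29)
  ∷ (31 * 31) ∷ (7 * 103) ∷ 1201 ∷ (7 * 127) ∷ (23 * 47) ∷ []

-- (a , b , c) is a solution of 4/n = 1/a + 1/b + 1/c with positive integers
-- a ≤ b ≤ c.  Cleared of denominators (valid since a,b,c,n > 0):
-- 4abc = n(bc + ac + ab).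
IsSolution : ℕ → ℕ → ℕ → ℕ → Set
IsSolution n a b c =
  1 ≤ a × a ≤ b × b ≤ c × 4 * (a * b * c) ≡ n * (b * c + a * c + a * b)

HasSolution : ℕ → Set
HasSolution n = ∃[ a ] ∃[ b ] ∃[ c ] IsSolution n a b c

-- n ∈ C_i : a solution with a ≤ (n + 4i - 1)/4 (rational inequality),
-- i.e. 4a ≤ n + 4i - 1.
InC : ℕ → ℕ → Set
InC i n = ∃[ a ] ∃[ b ] ∃[ c ] (IsSolution n a b c × 4 * a ≤ n + 4 * i ∸ 1)

module Submission where

-- Every positive n outside the residue set E modulo 1320 lies
-- in a residue class n ≡ r (mod M), with M ∣ 1320, on which the equation
-- 4/n = 1/a + 1/b + 1/c has an explicit solution whose entries are
-- polynomials in q = n div M, with a = ⌈n/4⌉ + (small constant) so that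
-- 4a ≤ n + 11, which is exactly the bound defining C₃.
--
-- Multiples
--     of 4 (where q = 0 would give n = 0) get a separate explicit solution.
--   * A table of 14 families; its validity and the fact that, together
--     with E and the multiples of 4, it covers all 1320 residues are
--     checked by computation.

open import Defs
open import Data.Nat using (ℕ; zero; suc; _+_; _*_; _%_; _/_; _≤_; _<_; s≤s; z≤n; NonZero; >-nonZero⁻¹)
open import Data.Nat.Properties
open import Data.Nat.DivMod using (m≡m%n+[m/n]*n; m∣n⇒o%n%m≡o%m; m%n<n)
open import Data.Nat.Divisibility using (_∣_; _∣?_; divides)
open import Data.Nat.Primality using (Prime; prime⇒nonZero)
open import Data.Nat.Tactic.RingSolver using (solve-∀)
open import Data.List using (List; []; _∷_)
open import Data.List.Properties using (≡-dec)
open import Data.List.Membership.Propositional using (_∈_)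
open import Data.List.Membership.DecPropositional _≟_ using (_∈?_)
open import Data.List.Relation.Unary.All using (All; all?; lookupAny)
open import Data.List.Relation.Unary.Any as Any using (Any; any?)
open import Data.Product using (_×_; _,_; proj₁; proj₂)
open import Data.Sum using (_⊎_; inj₁; inj₂; [_,_]′)
open import Data.Empty using (⊥-elim)
open import Relation.Nullary using (¬_; Dec; yes; no)
open import Data.Bool using (Bool; true; T; _∧_)
open import Data.Bool.Properties using (T-∧)
open import Function.Bundles using (Equivalence)
open import Function using (_∘_; id)
open import Relation.Nullary.Decidable using (toWitness; isYes; _×-dec_; _⊎-dec_)
open import Relation.Binary.PropositionalEquality using (_≡_; refl; sym; trans; cong; cong₂; subst; module ≡-Reasoning)

-- Polynomials over ℕ as coefficient lists, constant term first.
Poly : Set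
Poly = List ℕ

⟦_⟧ : Poly → ℕ → ℕ
⟦ [] ⟧ x = 0
⟦ c ∷ p ⟧ x = c + x * ⟦ p ⟧ x

infixl 6 _⊕_
infixl 7 _⊗_
infixr 8 _·_

_⊕_ : Poly → Poly → Poly
[] ⊕ q = q
(a ∷ p) ⊕ [] = a ∷ p
(a ∷ p) ⊕ (b ∷ q) = a + b ∷ p ⊕ q

_·_ : ℕ → Poly → Poly
k · [] = []
k · (a ∷ p) = k * a ∷ k · p

_⊗_ : Poly → Poly → Poly
[] ⊗ q = []
(a ∷ p) ⊗ q = a · q ⊕ (0 ∷ p ⊗ q)

⟦⊕⟧ : ∀ p q x → ⟦ p ⊕ q ⟧ x ≡ ⟦ p ⟧ x + ⟦ q ⟧ x
⟦⊕⟧ [] q x = refl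
⟦⊕⟧ (a ∷ p) [] x = sym (+-identityʳ _)
⟦⊕⟧ (a ∷ p) (b ∷ q) x rewrite ⟦⊕⟧ p q x = shuffle a b x (⟦ p ⟧ x) (⟦ q ⟧ x)
  where
  shuffle : ∀ a b x u v → a + b + x * (u + v) ≡ a + x * u + (b + x * v)
  shuffle = solve-∀

⟦·⟧ : ∀ k p x → ⟦ k · p ⟧ x ≡ k * ⟦ p ⟧ x
⟦·⟧ k [] x = sym (*-zeroʳ k)
⟦·⟧ k (a ∷ p) x rewrite ⟦·⟧ k p x = distribute k a x (⟦ p ⟧ x)
  where
  distribute : ∀ k a x u → k * a + x * (k * u) ≡ k * (a + x * u)
  distribute = solve-∀

⟦⊗⟧ : ∀ p q x → ⟦ p ⊗ q ⟧ x ≡ ⟦ p ⟧ x * ⟦ q ⟧ x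
⟦⊗⟧ [] q x = refl
⟦⊗⟧ (a ∷ p) q x rewrite ⟦⊕⟧ (a · q) (0 ∷ p ⊗ q) x | ⟦·⟧ a q x | ⟦⊗⟧ p q x =
  distribute a x (⟦ p ⟧ x) (⟦ q ⟧ x)
  where
  distribute : ∀ a x u v → a * v + x * (u * v) ≡ (a + x * u) * v
  distribute = solve-∀

⟦linear⟧ : ∀ c m x → ⟦ c ∷ m ∷ [] ⟧ x ≡ m * x + c
⟦linear⟧ = horner
  where
  horner : ∀ c m x → c + x * (m + x * 0) ≡ m * x + c
  horner = solve-∀

PolyIdentity : Poly → Poly → Poly → Poly → Set
PolyIdentity N A B C = 4 · (A ⊗ B ⊗ C) ≡ N ⊗ (B ⊗ C ⊕ A ⊗ C ⊕ A ⊗ B)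

identity-at : ∀ N A B C → PolyIdentity N A B C → ∀ x →
  let n = ⟦ N ⟧ x; a = ⟦ A ⟧ x; b = ⟦ B ⟧ x; c = ⟦ C ⟧ x in
  4 * (a * b * c) ≡ n * (b * c + a * c + a * b)
identity-at N A B C eq x = begin
  4 * (a * b * c)                             ≡⟨ cong (4 *_) (cong (_* c) (sym (⟦⊗⟧ A B x))) ⟩
  4 * (⟦ A ⊗ B ⟧ x * c)                       ≡⟨ cong (4 *_) (sym (⟦⊗⟧ (A ⊗ B) C x)) ⟩
  4 * ⟦ A ⊗ B ⊗ C ⟧ x                         ≡⟨ sym (⟦·⟧ 4 (A ⊗ B ⊗ C) x) ⟩
  ⟦ 4 · (A ⊗ B ⊗ C) ⟧ x                       ≡⟨ cong (λ p → ⟦ p ⟧ x) eq ⟩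
  ⟦ N ⊗ (B ⊗ C ⊕ A ⊗ C ⊕ A ⊗ B) ⟧ x           ≡⟨ ⟦⊗⟧ N _ x ⟩
  n * ⟦ B ⊗ C ⊕ A ⊗ C ⊕ A ⊗ B ⟧ x             ≡⟨ cong (n *_) sum-of-products ⟩
  n * (b * c + a * c + a * b)                 ∎
  where
  open ≡-Reasoning
  n a b c : ℕ
  n = ⟦ N ⟧ x
  a = ⟦ A ⟧ x
  b = ⟦ B ⟧ x
  c = ⟦ C ⟧ x
  sum-of-products : ⟦ B ⊗ C ⊕ A ⊗ C ⊕ A ⊗ B ⟧ x ≡ b * c + a * c + a * b
  sum-of-products = begin
    ⟦ B ⊗ C ⊕ A ⊗ C ⊕ A ⊗ B ⟧ x                 ≡⟨ ⟦⊕⟧ (B ⊗ C ⊕ A ⊗ C) (A ⊗ B) x ⟩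
    ⟦ B ⊗ C ⊕ A ⊗ C ⟧ x + ⟦ A ⊗ B ⟧ x           ≡⟨ cong (_+ ⟦ A ⊗ B ⟧ x) (⟦⊕⟧ (B ⊗ C) (A ⊗ C) x) ⟩
    ⟦ B ⊗ C ⟧ x + ⟦ A ⊗ C ⟧ x + ⟦ A ⊗ B ⟧ x     ≡⟨ cong₂ _+_ (cong₂ _+_ (⟦⊗⟧ B C x) (⟦⊗⟧ A C x)) (⟦⊗⟧ A B x) ⟩
    b * c + a * c + a * b                       ∎

-- The bound of C₃, 4a ≤ n + 4·3 − 1, in the form 4a ≤ n + 11.
InC₃-intro : ∀ {n} a b c → IsSolution n a b c → 4 * a ≤ n + 11 → InC 3 n
InC₃-intro {n} a b c sol bound =
  a , b , c , sol , subst (4 * a ≤_) (sym (+-∸-assoc n {12} {1} (s≤s z≤n))) bound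

InC⇒HasSolution : ∀ i n → InC i n → HasSolution n
InC⇒HasSolution i n (a , b , c , sol , _) = a , b , c , sol

-- n = 4m with m ≥ 1: 4/(4m) = 1/(m+1) + 2/(2m(m+1)).
multiple-of-4∈C₃ : ∀ m → 1 ≤ m → InC 3 (4 * m)
multiple-of-4∈C₃ m 1≤m = InC₃-intro (suc m) d d (s≤s z≤n , a≤d , ≤-refl , identity m) bound
  where
  d : ℕ
  d = 2 * m * suc m
  a≤d : suc m ≤ d
  a≤d = subst (_≤ d) (*-identityˡ (suc m)) (*-monoˡ-≤ (suc m) (≤-trans 1≤m (m≤n*m m 2)))
  identity : ∀ m → 4 * (suc m * (2 * m * suc m) * (2 * m * suc m))
                 ≡ 4 * m * (2 * m * suc m * (2 * m * suc m) + suc m * (2 * m * suc m)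
                            + suc m * (2 * m * suc m))
  identity = solve-∀
  bound : 4 * suc m ≤ 4 * m + 11
  bound = begin
    4 * suc m   ≡⟨ *-suc 4 m ⟩
    4 + 4 * m   ≡⟨ +-comm 4 (4 * m) ⟩
    4 * m + 4   ≤⟨ +-monoʳ-≤ (4 * m) (m≤m+n 4 7) ⟩
    4 * m + 11  ∎
    where open ≤-Reasoning

record Family : Set where
  constructor family
  field
    M k r α : ℕ
    d₁ d₂ : Poly
    ⦃ M≢0 ⦄ : NonZero M

  N A B C : Poly
  N = r ∷ M ∷ []
  A = α ∷ k ∷ []
  B = A ⊕ d₁
  C = B ⊕ d₂

open Family

instance
  family-M≢0 : ∀ {f} → NonZero (M f)
  family-M≢0 {f} = M≢0 f

-- A family is valid when M = 4k divides 1320, a is positive, the C₃ bound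
-- 4a = n + (4α − r) ≤ n + 11 holds and the polynomial identity holds.
Valid : Family → Set
Valid f = M f ≡ 4 * k f × M f ∣ 1320 × 1 ≤ α f × 4 * α f ≤ r f + 11
        × PolyIdentity (N f) (A f) (B f) (C f)

valid? : ∀ f → Dec (Valid f)
valid? f = (M f ≟ 4 * k f) ×-dec (M f ∣? 1320) ×-dec (1 ≤? α f) ×-dec (4 * α f ≤? r f + 11)
         ×-dec ≡-dec _≟_ _ _

InClass : ℕ → Family → Set
InClass t f = t % M f ≡ r f

family∈C₃ : ∀ f → Valid f → ∀ q → InC 3 (M f * q + r f)
family∈C₃ f (M≡4k , _ , 1≤α , slack , identity) q =
  InC₃-intro a b c (1≤a , a≤b , b≤c , sol) bound
  where
  a b c n : ℕ
  a = ⟦ A f ⟧ q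
  b = ⟦ B f ⟧ q
  c = ⟦ C f ⟧ q
  n = M f * q + r f
  1≤a : 1 ≤ a
  1≤a = ≤-trans 1≤α (m≤m+n (α f) _)
  a≤b : a ≤ b
  a≤b = subst (a ≤_) (sym (⟦⊕⟧ (A f) (d₁ f) q)) (m≤m+n a _)
  b≤c : b ≤ c
  b≤c = subst (b ≤_) (sym (⟦⊕⟧ (B f) (d₂ f) q)) (m≤m+n b _)
  sol : 4 * (a * b * c) ≡ n * (b * c + a * c + a * b)
  sol = subst (λ m → 4 * (a * b * c) ≡ m * (b * c + a * c + a * b))
          (⟦linear⟧ (r f) (M f) q) (identity-at (N f) (A f) (B f) (C f) identity q)
  bound : 4 * a ≤ n + 11
  bound = begin
    4 * a                       ≡⟨ cong (4 *_) (⟦linear⟧ (α f) (k f) q) ⟩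
    4 * (k f * q + α f)         ≡⟨ *-distribˡ-+ 4 (k f * q) (α f) ⟩
    4 * (k f * q) + 4 * α f     ≡⟨ cong (_+ 4 * α f) (sym (*-assoc 4 (k f) q)) ⟩
    4 * k f * q + 4 * α f       ≡⟨ cong (λ m → m * q + 4 * α f) (sym M≡4k) ⟩
    M f * q + 4 * α f           ≤⟨ +-monoʳ-≤ (M f * q) slack ⟩
    M f * q + (r f + 11)        ≡⟨ sym (+-assoc (M f * q) (r f) 11) ⟩
    n + 11                      ∎
    where open ≤-Reasoning

family-member : ∀ f → Valid f → ∀ n → InClass (n % 1320) f → InC 3 n
family-member f valid@(_ , M∣1320 , _) n hit =
  subst (InC 3) (sym n≡Mq+r) (family∈C₃ f valid (n / M f))
  where
  residue : n % M f ≡ r f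
  residue = trans (sym (m∣n⇒o%n%m≡o%m (M f) 1320 n M∣1320)) hit
  n≡Mq+r : n ≡ M f * (n / M f) + r f
  n≡Mq+r = begin
    n                         ≡⟨ m≡m%n+[m/n]*n n (M f) ⟩
    n % M f + n / M f * M f   ≡⟨ +-comm (n % M f) _ ⟩
    n / M f * M f + n % M f   ≡⟨ cong₂ _+_ (*-comm (n / M f) (M f)) residue ⟩
    M f * (n / M f) + r f     ∎
    where open ≡-Reasoning

families : List Family
families =
    family 4 1 3 1 (5 ∷ 13 ∷ 8 ∷ []) (0 ∷ [])
  ∷ family 4 1 2 1 (1 ∷ 5 ∷ 4 ∷ []) (0 ∷ [])
  ∷ family 8 2 5 2 (3 ∷ 11 ∷ 8 ∷ []) (5 ∷ 13 ∷ 8 ∷ [])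
  ∷ family 12 3 5 2 (2 ∷ 11 ∷ 12 ∷ []) (16 ∷ 104 ∷ 216 ∷ 144 ∷ [])
  ∷ family 12 3 9 3 (15 ∷ 39 ∷ 24 ∷ []) (0 ∷ [])
  ∷ family 20 5 5 2 (2 ∷ 21 ∷ 40 ∷ []) (16 ∷ 104 ∷ 160 ∷ [])
  ∷ family 20 5 13 5 (5 ∷ 20 ∷ 15 ∷ []) (120 ∷ 370 ∷ 285 ∷ [])
  ∷ family 20 5 17 5 (29 ∷ 69 ∷ 40 ∷ []) (136 ∷ 296 ∷ 160 ∷ [])
  ∷ family 44 11 21 8 (8 ∷ 43 ∷ 44 ∷ []) (320 ∷ 1784 ∷ 3256 ∷ 1936 ∷ [])
  ∷ family 44 11 29 10 (19 ∷ 62 ∷ 44 ∷ []) (261 ∷ 976 ∷ 1199 ∷ 484 ∷ [])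
  ∷ family 44 11 33 9 (99 ∷ 265 ∷ 176 ∷ []) (1080 ∷ 2760 ∷ 1760 ∷ [])
  ∷ family 44 11 41 11 (153 ∷ 329 ∷ 176 ∷ []) (1640 ∷ 3400 ∷ 1760 ∷ [])
  ∷ family 220 55 149 40 (520 ∷ 1515 ∷ 1100 ∷ []) (16128 ∷ 69856 ∷ 100760 ∷ 48400 ∷ [])
  ∷ family 220 55 189 50 (810 ∷ 1891 ∷ 1100 ∷ []) (811840 ∷ 2783024 ∷ 3179000 ∷ 1210000 ∷ [])
  ∷ []

families-valid : All Valid families
families-valid = toWitness {a? = all? valid? families} _

Covered : ℕ → Set
Covered t = t ∈ E ⊎ t % 4 ≡ 0 ⊎ Any (InClass t) families

covered? : ∀ t → Dec (Covered t)
covered? t = (t ∈? E) ⊎-dec (t % 4 ≟ 0) ⊎-dec any? (λ f → t % M f ≟ r f) families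

allBelow : (ℕ → Bool) → ℕ → Bool
allBelow p zero    = true
allBelow p (suc n) = p n ∧ allBelow p n

allBelow-sound : ∀ p n → T (allBelow p n) → ∀ t → t < n → T (p t)
allBelow-sound p (suc n) ok t t<1+n with t ≟ n
... | yes refl = proj₁ (Equivalence.to T-∧ ok)
... | no t≢n   = allBelow-sound p n (proj₂ (Equivalence.to T-∧ ok)) t (≤∧≢⇒< (≤-pred t<1+n) t≢n)

-- Decided by testing each of the 1320 residues; only the Boolean outcome
-- of covered? is evaluated, which keeps the check cheap.
all-residues-covered : ∀ t → t < 1320 → Covered t
all-residues-covered t t<1320 =
  toWitness (allBelow-sound (λ s → isYes (covered? s)) 1320 _ t t<1320)

-- Since 4 ∣ 1320, the residue n % 1320 determines n % 4.
n≡4[n/4] : ∀ n → (n % 1320) % 4 ≡ 0 → n ≡ 4 * (n / 4)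
n≡4[n/4] n hit = begin
  n                 ≡⟨ m≡m%n+[m/n]*n n 4 ⟩
  n % 4 + n / 4 * 4 ≡⟨ cong₂ _+_ (trans (sym (m∣n⇒o%n%m≡o%m 4 1320 n (divides 330 refl))) hit) (*-comm (n / 4) 4) ⟩
  4 * (n / 4)       ∎
  where open ≡-Reasoning

multiple-of-4 : ∀ n → 1 ≤ n → (n % 1320) % 4 ≡ 0 → InC 3 n
multiple-of-4 n 1≤n hit with n / 4 | n≡4[n/4] n hit
... | zero  | n≡0  = ⊥-elim (<⇒≢ 1≤n (sym n≡0))
... | suc m | n≡4m = subst (InC 3) (sym n≡4m) (multiple-of-4∈C₃ (suc m) (s≤s z≤n))

covered⇒exceptional-or-C₃ : ∀ n → 1 ≤ n → Covered (n % 1320) → n % 1320 ∈ E ⊎ InC 3 n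
covered⇒exceptional-or-C₃ n 1≤n (inj₁ exceptional) = inj₁ exceptional
covered⇒exceptional-or-C₃ n 1≤n (inj₂ (inj₁ divisible-by-4)) = inj₂ (multiple-of-4 n 1≤n divisible-by-4)
covered⇒exceptional-or-C₃ n 1≤n (inj₂ (inj₂ hit)) =
  inj₂ (family-member f valid n in-class)
  where
  f : Family
  f = Any.lookup hit
  valid : Valid f
  valid = proj₁ (lookupAny families-valid hit)
  in-class : InClass (n % 1320) f
  in-class = proj₂ (lookupAny families-valid hit)

exceptional-or-C₃ : ∀ n → 1 ≤ n → n % 1320 ∈ E ⊎ InC 3 n
exceptional-or-C₃ n 1≤n = covered⇒exceptional-or-C₃ n 1≤n (all-residues-covered (n % 1320) (m%n<n n 1320))

theorem2p1 : ((n : ℕ) → Prime n → ¬ (n % 1320 ∈ E) → HasSolution n)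
    × ((n : ℕ) → 1 ≤ n → ¬ InC 3 n → n % 1320 ∈ E)
theorem2p1 = solvable , outside-C₃-exceptional
  where
  solvable : (n : ℕ) → Prime n → ¬ (n % 1320 ∈ E) → HasSolution n
  solvable n n-prime not-exceptional =
    [ ⊥-elim ∘ not-exceptional , InC⇒HasSolution 3 n ]′
      (exceptional-or-C₃ n (>-nonZero⁻¹ n ⦃ prime⇒nonZero n-prime ⦄))

  outside-C₃-exceptional : (n : ℕ) → 1 ≤ n → ¬ InC 3 n → n % 1320 ∈ E
  outside-C₃-exceptional n 1≤n n∉C₃ = [ id , ⊥-elim ∘ n∉C₃ ]′ (exceptional-or-C₃ n 1≤n)
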